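{- For each even $n\geq 8$ there is a signed graph $(H_n,\sigma_n)$ of order $n$ such that $C_r(H_n,\sigma_n)<\ell(H_n,\sigma_n)$, and $\lim_{n\to\infty}\frac{C_r(H_n,\sigma_n)}{\ell(H_n,\sigma_n)}=1$.
   Context: A signed graph $(G,\sigma)$ is a finite simple graph $G$ with a map $\sigma\colon E(G)\to\{+,-\}$ ($\{\pm\}$ viewed as a multiplicative group). A subgraph is balanced if each of its circuits contains an even number of negative edges. The frustration index $\ell(G,\sigma)$ is the minimum cardinality of a set $E\subseteq E(G)$ such that $G-E$ with the restricted signature is balanced. Relaxed information dissemination (rID) process on $(G,\sigma)$: each vertex has a state in $\{A,-A,C,0\}$, initially all $0$. In step $i\geq 1$: choose a vertex $v_i$ of state $0$ (a placement vertex) and set its state to $A$ or to $-A$ (either choice allowed). Then, simultaneously for every vertex $v$ currently in state $0$, consider its neighbours $z$ currently in state $A$ or $-A$ (states after placing $v_i$, before this step's updates); each such $z$ sends $\sigma(vz)\cdot\mathrm{state}(z)$ (with $-(-A)=A$). If $v$ has no such neighbour it stays $0$; if all sent values are equal, $v$ takes that value; if two sent values differ, $v$ gets state $C$ (confused). Vertices with state $A$, $-A$ or $C$ keep their state. Repeat until no vertex has state $0$. The value of the run is the number of vertices of final state $C$. The relaxed confusion number $C_r(G,\sigma)$ is the minimum value over all possible runs. -}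

module Defs where

open import Data.Nat using (ℕ; zero; suc; _+_; _*_; _∸_; _≤_; _<_)
open import Data.Nat.Divisibility using (_∣_)
open import Data.Fin using (Fin; toℕ)
open import Data.Bool using (Bool; true; false; _∧_; not; if_then_else_)
open import Data.List using (List; []; _∷_; _++_; [_]; length; allFin; foldr)
open import Data.List.Relation.Unary.All using (All)
open import Data.List.Relation.Unary.Unique.Propositional using (Unique)
open import Data.Product using (Σ; ∃; _×_; _,_)
open import Relation.Binary.PropositionalEquality using (_≡_; _≢_)
open import Relation.Nullary using (does)
import Data.Fin as Fin

data Sign : Set where
  pos neg : Sign

-- Signed graphs on the vertex set Fin n (order n), finite and simple:
-- adjacency is a symmetric, irreflexive Bool matrix; the signature is a
-- symmetric sign matrix (only its values on edges matter).

record SignedGraph (n : ℕ) : Set where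
  field
    adj        : Fin n → Fin n → Bool
    adj-sym    : ∀ i j → adj i j ≡ adj j i
    adj-irrefl : ∀ i → adj i i ≡ false
    sign       : Fin n → Fin n → Sign
    sign-sym   : ∀ i j → sign i j ≡ sign j i
open SignedGraph public

consecPairs : ∀ {n} → List (Fin n) → List (Fin n × Fin n)
consecPairs []             = []
consecPairs (x ∷ [])       = []
consecPairs (x ∷ y ∷ rest) = (x , y) ∷ consecPairs (y ∷ rest)

closedPairs : ∀ {n} → List (Fin n) → List (Fin n × Fin n)
closedPairs []       = []
closedPairs (x ∷ xs) = consecPairs ((x ∷ xs) ++ [ x ])

IsCircuit : ∀ {n} → (Fin n → Fin n → Bool) → List (Fin n) → Set
IsCircuit E cs =
  3 ≤ length cs × Unique cs × All (λ { (i , j) → E i j ≡ true }) (closedPairs cs)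

negCount : ∀ {n} → (Fin n → Fin n → Sign) → List (Fin n × Fin n) → ℕ
negCount σ = foldr (λ { (i , j) k → isNeg (σ i j) + k }) 0
  where
  isNeg : Sign → ℕ
  isNeg pos = 0
  isNeg neg = 1

Balanced : ∀ {n} → (Fin n → Fin n → Bool) → (Fin n → Fin n → Sign) → Set
Balanced E σ = ∀ cs → IsCircuit E cs → 2 ∣ negCount σ (closedPairs cs)

countFin : ∀ {n} → (Fin n → Bool) → ℕ
countFin {n} p = foldr (λ i k → (if p i then 1 else 0) + k) 0 (allFin n)

record EdgeSet {n : ℕ} (G : SignedGraph n) : Set where
  field
    mem     : Fin n → Fin n → Bool
    mem-sym : ∀ i j → mem i j ≡ mem j i
    mem-adj : ∀ i j → mem i j ≡ true → adj G i j ≡ true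
open EdgeSet public

ltB : ℕ → ℕ → Bool
ltB zero    zero    = false
ltB zero    (suc _) = true
ltB (suc _) zero    = false
ltB (suc m) (suc k) = ltB m k

card : ∀ {n} {G : SignedGraph n} → EdgeSet G → ℕ
card E = foldr (λ i k → countFin (λ j → ltB (toℕ i) (toℕ j) ∧ mem E i j) + k) 0 (allFin _)

deleteAdj : ∀ {n} (G : SignedGraph n) → EdgeSet G → Fin n → Fin n → Bool
deleteAdj G E i j = adj G i j ∧ not (mem E i j)

IsFrustrationIndex : ∀ {n} → SignedGraph n → ℕ → Set
IsFrustrationIndex G m =
  (Σ (EdgeSet G) λ E → Balanced (deleteAdj G E) (sign G) × card E ≡ m) ×
  (∀ (E : EdgeSet G) → Balanced (deleteAdj G E) (sign G) → m ≤ card E)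

data St : Set where
  A mA C O : St     -- A, -A, C (confused), 0

eqSt : St → St → Bool
eqSt A  A  = true
eqSt mA mA = true
eqSt C  C  = true
eqSt O  O  = true
eqSt _  _  = false

-- σ · state  (only applied to states A, -A)
act : Sign → St → St
act pos s  = s
act neg A  = mA
act neg mA = A
act neg s  = s

isInformed : St → Bool
isInformed A  = true
isInformed mA = true
isInformed _  = false

data Msgs : Set where
  none : Msgs
  one  : St → Msgs
  conf : Msgs

addMsg : St → Msgs → Msgs
addMsg x none    = one x
addMsg x (one y) = if eqSt x y then one y else conf
addMsg x conf    = conf

fromMsgs : Msgs → St
fromMsgs none    = O
fromMsgs (one x) = x
fromMsgs conf    = C

Config : ℕ → Set
Config n = Fin n → St

place : ∀ {n} → Config n → Fin n → Bool → Config n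
place s v a w = if does (v Fin.≟ w) then (if a then A else mA) else s w

received : ∀ {n} → SignedGraph n → Config n → Fin n → Msgs
received {n} G t w =
  foldr (λ z acc → if adj G w z ∧ isInformed (t z)
                     then addMsg (act (sign G w z) (t z)) acc
                     else acc)
        none (allFin n)

update : ∀ {n} → SignedGraph n → Config n → Config n
update G t w with t w
... | O = fromMsgs (received G t w)
... | x = x

rIDStep : ∀ {n} → SignedGraph n → Config n → Fin n → Bool → Config n
rIDStep G s v a = update G (place s v a)

data Reachable {n : ℕ} (G : SignedGraph n) : Config n → Set where
  start : Reachable G (λ _ → O)
  step  : ∀ {s} → Reachable G s → (v : Fin n) → s v ≡ O → (a : Bool) →
          Reachable G (rIDStep G s v a)

Final : ∀ {n} → Config n → Set
Final s = ∀ v → s v ≢ O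

countC : ∀ {n} → Config n → ℕ
countC s = countFin (λ v → eqSt (s v) C)

IsRelaxedConfusionNumber : ∀ {n} → SignedGraph n → ℕ → Set
IsRelaxedConfusionNumber G c =
  (Σ (Config _) λ s → Reachable G s × Final s × countC s ≡ c) ×
  (∀ s → Reachable G s → Final s → c ≤ countC s)

-- H n is the complete bipartite graph between the even and the odd vertices of Fin n in which
-- the rungs {2t, 2t+1} with t < n/2 − 2 are negative; vertex i lies at level ⌊ i /2⌋.
--
-- On a complete bipartite graph the first placement v informs the whole other side and the
-- second one (necessarily beside v) informs everything else, so every run stops after two steps.
-- A vertex w beside v then hears σ(wz)σ(zv)·x from every z across, so it is confused iff w and v
-- lie on an unbalanced 4-cycle; in H n this happens iff w or v lies on a negative rung. Placing
-- first at the top level and then at level 0 confuses exactly the other n/2 − 3 even vertices on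
-- negative rungs, and no run does better: C_r = n/2 − 3.
--
-- Deleting the negative rungs balances H n, while the squares 2t, 2t+1, 2t+2, 2t+5 (t < n/2 − 2)
-- are edge-disjoint circuits with exactly one negative edge, so ℓ = n/2 − 2 = C_r + 1.

module Submission where

open import Data.Bool using (Bool; true; false; _∧_; _∨_; not; _xor_; if_then_else_)
open import Data.Bool.Properties using (∧-identityʳ; ∧-zeroʳ; ∧-conicalˡ; ∧-conicalʳ; xor-same; xor-comm; ¬-not; not-¬)
open import Data.Fin using (Fin; zero; suc; toℕ)
import Data.Bool as Bool
import Data.Fin as Fin
import Data.Fin.Properties as Fin
open import Data.Fin.Properties using (suc-injective; toℕ-injective)
open import Data.List using (List; []; _∷_; foldr; allFin)
open import Data.List.Membership.Propositional using (_∈_)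
open import Data.List.Membership.Propositional.Properties using (∈-allFin)
open import Data.List.Relation.Unary.Any using (Any; here; there; any?)
open import Data.List.Relation.Unary.All using (All; []; _∷_)
import Data.List.Relation.Unary.All as All
open import Data.List.Relation.Unary.All.Properties using (¬Any⇒All¬)
open import Data.List.Relation.Unary.AllPairs using ([]; _∷_)
open import Data.List.Properties using (foldr-map; map-tabulate)
open import Data.Nat using (ℕ; zero; suc; _+_; _*_; _≤_; _<_; _∸_; z≤n; s≤s; pred; ⌊_/2⌋)
import Data.Nat.Properties as ℕ
open import Data.Nat.Divisibility using (_∣_; divides; _∣0; ∣1⇒≡1)
open import Data.Nat.Properties using (≤-refl; ≤-reflexive; ≤-trans; +-mono-≤; +-suc; m≤n⇒m≤1+n; <-cmp)
open import Data.Sum using (_⊎_; inj₁; inj₂)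
open import Data.Product using (Σ; ∃; ∃₂; _×_; _,_; proj₁; proj₂; uncurry)
open import Data.Product.Properties using () renaming (≡-dec to ×-≡-dec)
open import Function using (_∘_; id; flip)
open import Function.Definitions using (Injective)
open import Relation.Binary.PropositionalEquality
  using (_≡_; _≢_; refl; sym; trans; cong; cong₂; subst; subst₂; module ≡-Reasoning)
open import Relation.Binary.Definitions using (DecidableEquality; tri<; tri≈; tri>)
open import Relation.Nullary using (¬_; does; yes; no; contradiction)
open import Relation.Nullary.Decidable using (dec-true; dec-false)

open import Defs

-- Sums and counts over Fin

ltB-complete : ∀ {m k} → m < k → ltB m k ≡ true
ltB-complete {zero}  {suc k} _         = refl
ltB-complete {suc m} {suc k} (s≤s m<k) = ltB-complete m<k

ltB-sound : ∀ {m k} → ltB m k ≡ true → m < k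
ltB-sound {zero}  {suc k} _  = s≤s z≤n
ltB-sound {suc m} {suc k} lt = s≤s (ltB-sound lt)

-- countFin p and card E unfold to sumFin (indicator ∘ p) and
-- countPairs (λ i j → ltB (toℕ i) (toℕ j) ∧ mem E i j).
sumFin : ∀ {n} → (Fin n → ℕ) → ℕ
sumFin f = foldr (λ i k → f i + k) 0 (allFin _)

sumFin-suc : ∀ {n} (f : Fin (suc n) → ℕ) → sumFin f ≡ f zero + sumFin (f ∘ suc)
sumFin-suc {n} f = cong (f zero +_)
  (trans (cong (foldr add 0) (sym (map-tabulate id Fin.suc))) (foldr-map add Fin.suc 0 (allFin n)))
  where
  add : Fin (suc n) → ℕ → ℕ
  add i k = f i + k

sumFin-cong : ∀ {n} {f g : Fin n → ℕ} → (∀ i → f i ≡ g i) → sumFin f ≡ sumFin g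
sumFin-cong {zero}  f≗g = refl
sumFin-cong {suc n} {f} {g} f≗g = begin
  sumFin f                 ≡⟨ sumFin-suc f ⟩
  f zero + sumFin (f ∘ suc) ≡⟨ cong₂ _+_ (f≗g zero) (sumFin-cong (f≗g ∘ suc)) ⟩
  g zero + sumFin (g ∘ suc) ≡⟨ sym (sumFin-suc g) ⟩
  sumFin g                 ∎
  where open ≡-Reasoning


sumFin-mono : ∀ {n} {f g : Fin n → ℕ} → (∀ i → f i ≤ g i) → sumFin f ≤ sumFin g
sumFin-mono {zero}  f≤g = z≤n
sumFin-mono {suc n} {f} {g} f≤g =
  subst₂ _≤_ (sym (sumFin-suc f)) (sym (sumFin-suc g))
    (+-mono-≤ (f≤g zero) (sumFin-mono (f≤g ∘ suc)))

sumFin-point : ∀ {n} {f g : Fin n → ℕ} (a : Fin n) → f a ≡ suc (g a) →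
               (∀ i → i ≢ a → f i ≡ g i) → sumFin f ≡ suc (sumFin g)
sumFin-point {suc n} {f} {g} zero fa others = begin
  sumFin f                  ≡⟨ sumFin-suc f ⟩
  f zero + sumFin (f ∘ suc) ≡⟨ cong₂ _+_ fa (sumFin-cong λ i → others (suc i) λ ()) ⟩
  suc (g zero + sumFin (g ∘ suc)) ≡⟨ cong suc (sym (sumFin-suc g)) ⟩
  suc (sumFin g)            ∎
  where open ≡-Reasoning
sumFin-point {suc n} {f} {g} (suc a) fa others = begin
  sumFin f                  ≡⟨ sumFin-suc f ⟩
  f zero + sumFin (f ∘ suc)       ≡⟨ cong₂ _+_ (others zero λ ()) (sumFin-point a fa others′) ⟩
  g zero + suc (sumFin (g ∘ suc)) ≡⟨ +-suc (g zero) _ ⟩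
  suc (g zero + sumFin (g ∘ suc)) ≡⟨ cong suc (sym (sumFin-suc g)) ⟩
  suc (sumFin g)            ∎
  where
  open ≡-Reasoning
  others′ : ∀ i → i ≢ a → f (suc i) ≡ g (suc i)
  others′ i i≢a = others (suc i) (i≢a ∘ suc-injective)

indicator : Bool → ℕ
indicator b = if b then 1 else 0

countFin-suc : ∀ {n} (p : Fin (suc n) → Bool) → countFin p ≡ indicator (p zero) + countFin (p ∘ suc)
countFin-suc p = sumFin-suc (indicator ∘ p)

countFin-cong : ∀ {n} {p q : Fin n → Bool} → (∀ i → p i ≡ q i) → countFin p ≡ countFin q
countFin-cong p≗q = sumFin-cong (cong indicator ∘ p≗q)

countFin-mono : ∀ {n} {p q : Fin n → Bool} → (∀ i → p i ≡ true → q i ≡ true) → countFin p ≤ countFin q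
countFin-mono {p = p} {q} p⊆q = sumFin-mono λ i → indicator-mono (p i) (q i) (p⊆q i)
  where
  indicator-mono : ∀ x y → (x ≡ true → y ≡ true) → indicator x ≤ indicator y
  indicator-mono false y _   = z≤n
  indicator-mono true  y x⇒y rewrite x⇒y refl = ≤-refl

countFin-empty : ∀ {n} {p : Fin n → Bool} → (∀ i → p i ≡ false) → countFin p ≡ 0
countFin-empty {zero}  _ = refl
countFin-empty {suc n} {p} empty =
  trans (countFin-suc p) (cong₂ _+_ (cong indicator (empty zero)) (countFin-empty (empty ∘ suc)))

countFin-point : ∀ {n} {p q : Fin n → Bool} (a : Fin n) → p a ≡ true → q a ≡ false →
                 (∀ i → i ≢ a → p i ≡ q i) → countFin p ≡ suc (countFin q)
countFin-point a pa qa others =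
  sumFin-point a (subst₂ (λ x y → indicator x ≡ suc (indicator y)) (sym pa) (sym qa) refl)
                 (λ i i≢a → cong indicator (others i i≢a))

module Removal {A : Set} (_≟_ : DecidableEquality A) where

  _∖_ : (A → Bool) → A → A → Bool
  (p ∖ a) x = p x ∧ not (does (x ≟ a))

  ∖-self : ∀ p a → (p ∖ a) a ≡ false
  ∖-self p a rewrite dec-true (a ≟ a) refl = ∧-zeroʳ (p a)

  ∖-other : ∀ p {a x} → x ≢ a → (p ∖ a) x ≡ p x
  ∖-other p {a} {x} x≢a rewrite dec-false (x ≟ a) x≢a = ∧-identityʳ (p x)

  ∖-intro : ∀ {p a x} → p x ≡ true → x ≢ a → (p ∖ a) x ≡ true
  ∖-intro {p} px x≢a = trans (∖-other p x≢a) px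

  ∖-elim : ∀ {p a x} → (p ∖ a) x ≡ true → p x ≡ true × x ≢ a
  ∖-elim {p} {a} eq = ∧-conicalˡ _ _ eq , λ { refl → contradiction (trans (sym eq) (∖-self p a)) λ () }

module FinRemoval {n : ℕ} = Removal (Fin._≟_ {n})
open FinRemoval

countFin-∖ : ∀ {n} {p : Fin n → Bool} {a} → p a ≡ true → countFin p ≡ suc (countFin (p ∖ a))
countFin-∖ {p = p} {a} pa = countFin-point a pa (∖-self p a) (λ i i≢a → sym (∖-other p i≢a))

countFin-∖-≤ : ∀ {n} (p : Fin n → Bool) a → countFin p ≤ suc (countFin (p ∖ a))
countFin-∖-≤ p a with p a in pa
... | true  = ≤-reflexive (countFin-∖ {p = p} pa)
... | false = m≤n⇒m≤1+n (≤-reflexive (countFin-cong unchanged))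
  where
  unchanged : ∀ i → p i ≡ (p ∖ a) i
  unchanged i with i Fin.≟ a
  ... | yes refl = trans pa (sym (∧-zeroʳ (p i)))
  ... | no _     = sym (∧-identityʳ (p i))

countFin-≤1 : ∀ {n} (p : Fin n → Bool) → (∀ i j → p i ≡ true → p j ≡ true → i ≡ j) → countFin p ≤ 1
countFin-≤1 {zero}  p _ = z≤n
countFin-≤1 {suc n} p unique = subst (_≤ 1) (sym (countFin-suc p)) (bound (p zero) refl)
  where
  bound : ∀ b → p zero ≡ b → indicator b + countFin (p ∘ suc) ≤ 1
  bound false _  = countFin-≤1 (p ∘ suc) λ i j pi pj → suc-injective (unique _ _ pi pj)
  bound true  p0 = ≤-reflexive (cong suc (countFin-empty rest))
    where
    rest : ∀ i → p (suc i) ≡ false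
    rest i with p (suc i) in psi
    ... | true  = contradiction (unique _ _ psi p0) λ ()
    ... | false = refl

countPairs : ∀ {n} → (Fin n → Fin n → Bool) → ℕ
countPairs Q = sumFin (λ i → countFin (Q i))

module PairRemoval {n : ℕ} = Removal (×-≡-dec (Fin._≟_ {n}) (Fin._≟_ {n}))

countPairs-injection : ∀ {k n} (Q : Fin n → Fin n → Bool) (g : Fin k → Fin n × Fin n) →
                       Injective _≡_ _≡_ g → (∀ t → uncurry Q (g t) ≡ true) → k ≤ countPairs Q
countPairs-injection {zero}  Q g _     _   = z≤n
countPairs-injection {suc k} {n} Q g g-inj Q∘g =
  subst (suc k ≤_) (sym count-drop) (s≤s (countPairs-injection Q′ (g ∘ suc) (suc-injective ∘ g-inj) Q′∘g))
  where
  open PairRemoval using () renaming (_∖_ to _∖₂_; ∖-self to ∖₂-self; ∖-other to ∖₂-other; ∖-intro to ∖₂-intro)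
  a b : Fin n
  a = proj₁ (g zero)
  b = proj₂ (g zero)
  Q′ : Fin n → Fin n → Bool
  Q′ i j = (uncurry Q ∖₂ (a , b)) (i , j)
  Q′∘g : ∀ t → uncurry Q′ (g (suc t)) ≡ true
  Q′∘g t = ∖₂-intro {p = uncurry Q} (Q∘g (suc t)) (λ eq → contradiction (g-inj eq) λ ())
  count-drop : countPairs Q ≡ suc (countPairs Q′)
  count-drop = sumFin-point a
    (countFin-point b (Q∘g zero) (∖₂-self (uncurry Q) (a , b))
       (λ j j≢b → sym (∖₂-other (uncurry Q) {x = a , j} (j≢b ∘ cong proj₂))))
    (λ i i≢a → countFin-cong λ j → sym (∖₂-other (uncurry Q) {x = i , j} (i≢a ∘ cong proj₁)))

countPairs-functional : ∀ {n} (Q : Fin n → Fin n → Bool) (r : Fin n → Bool) →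
                        (∀ i j → Q i j ≡ true → r i ≡ true) →
                        (∀ i j j′ → Q i j ≡ true → Q i j′ ≡ true → j ≡ j′) → countPairs Q ≤ countFin r
countPairs-functional Q r domain functional = sumFin-mono row
  where
  row : ∀ i → countFin (Q i) ≤ indicator (r i)
  row i with r i in ri
  ... | true  = countFin-≤1 (Q i) (λ j j′ → functional i j j′)
  ... | false = ≤-reflexive (countFin-empty outside)
    where
    outside : ∀ j → Q i j ≡ false
    outside j with Q i j in qij
    ... | true  = contradiction (trans (sym (domain i j qij)) ri) λ ()
    ... | false = refl

-- Messages and updates in the rID process

eqSt-refl : ∀ x → eqSt x x ≡ true
eqSt-refl A  = refl
eqSt-refl mA = refl
eqSt-refl C  = refl
eqSt-refl O  = refl

eqSt-sound : ∀ x y → eqSt x y ≡ true → x ≡ y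
eqSt-sound A  = λ { A  _ → refl ; mA () ; C  () ; O () }
eqSt-sound mA = λ { mA _ → refl ; A  () ; C  () ; O () }
eqSt-sound C  = λ { C  _ → refl ; A  () ; mA () ; O () }
eqSt-sound O  = λ { O  _ → refl ; A  () ; mA () ; C () }

addMsg-one : ∀ {x} y r → addMsg y r ≡ one x → y ≡ x × (r ≡ none ⊎ r ≡ one x)
addMsg-one y none    refl = refl , inj₁ refl
addMsg-one y (one z) eq with eqSt y z in same
addMsg-one y (one z) refl | true = eqSt-sound y z same , inj₂ refl

-- received G t w unfolds to gather (Informs G t w) (message G t w) (allFin n).
gather : ∀ {n} → (Fin n → Bool) → (Fin n → St) → List (Fin n) → Msgs
gather F M = foldr (λ z acc → if F z then addMsg (M z) acc else acc) none

module _ {n} (F : Fin n → Bool) (M : Fin n → St) where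

  gather-silent : (∀ z → F z ≡ false) → ∀ zs → gather F M zs ≡ none
  gather-silent silent []       = refl
  gather-silent silent (z ∷ zs) rewrite silent z = gather-silent silent zs

  gather-heard : ∀ {z zs} → z ∈ zs → F z ≡ true → gather F M zs ≢ none
  gather-heard {zs = z′ ∷ zs} z∈ Fz with F z′ in Fz′ | z∈
  ... | true  | _          = addMsg-≢none (M z′) (gather F M zs)
    where
    addMsg-≢none : ∀ x r → addMsg x r ≢ none
    addMsg-≢none x none    ()
    addMsg-≢none x (one y) with eqSt x y
    ... | true  = λ ()
    ... | false = λ ()
    addMsg-≢none x conf    ()
  ... | false | here refl  = contradiction (trans (sym Fz′) Fz) λ ()
  ... | false | there z∈′ = gather-heard z∈′ Fz

  gather-sound : ∀ {x z zs} → gather F M zs ≡ one x → z ∈ zs → F z ≡ true → M z ≡ x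
  gather-sound {zs = z′ ∷ zs} eq z∈ Fz with F z′ in Fz′ | z∈
  ... | false | here refl  = contradiction (trans (sym Fz′) Fz) λ ()
  ... | false | there z∈′ = gather-sound eq z∈′ Fz
  ... | true  | here refl  = proj₁ (addMsg-one (M z′) (gather F M zs) eq)
  ... | true  | there z∈′ with proj₂ (addMsg-one (M z′) (gather F M zs) eq)
  ...   | inj₁ silent = contradiction silent (gather-heard z∈′ Fz)
  ...   | inj₂ agreed = gather-sound agreed z∈′ Fz

  gather-uniform : ∀ {x} → (∀ z → F z ≡ true → M z ≡ x) → ∀ zs →
                   gather F M zs ≡ none ⊎ gather F M zs ≡ one x
  gather-uniform uniform []       = inj₁ refl
  gather-uniform {x} uniform (z ∷ zs) with F z in Fz | gather-uniform uniform zs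
  ... | false | rest        = rest
  ... | true  | inj₁ silent rewrite silent | uniform z Fz = inj₂ refl
  ... | true  | inj₂ agreed rewrite agreed | uniform z Fz | eqSt-refl x = inj₂ refl

Informed : St → Set
Informed x = isInformed x ≡ true

informed-act : ∀ s {x} → Informed x → Informed (act s x)
informed-act pos     inf = inf
informed-act neg {A}  _  = refl
informed-act neg {mA} _  = refl

informed⇒≢O : ∀ {x} → Informed x → x ≢ O
informed⇒≢O {A}  _ ()
informed⇒≢O {mA} _ ()

informed⇒≢C : ∀ {x} → Informed x → x ≢ C
informed⇒≢C {A}  _ ()
informed⇒≢C {mA} _ ()

placed : Bool → St
placed a = if a then A else mA

informed-placed : ∀ a → Informed (placed a)
informed-placed true  = refl
informed-placed false = refl

_·_ : Sign → Sign → Sign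
pos · s   = s
neg · pos = neg
neg · neg = pos

act-· : ∀ s s′ x → act (s · s′) x ≡ act s (act s′ x)
act-· pos s′  x  = refl
act-· neg pos x  = refl
act-· neg neg A  = refl
act-· neg neg mA = refl
act-· neg neg C  = refl
act-· neg neg O  = refl

act-cancel : ∀ {x} → Informed x → ∀ s s′ → act s x ≡ act s′ x → s ≡ s′
act-cancel {A}  _ pos pos _ = refl
act-cancel {A}  _ neg neg _ = refl
act-cancel {mA} _ pos pos _ = refl
act-cancel {mA} _ neg neg _ = refl

place-here : ∀ {n} (s : Config n) v a → place s v a v ≡ placed a
place-here s v a rewrite dec-true (v Fin.≟ v) refl = refl

place-elsewhere : ∀ {n} (s : Config n) {v} a {w} → w ≢ v → place s v a w ≡ s w
place-elsewhere s {v} a {w} w≢v rewrite dec-false (v Fin.≟ w) (w≢v ∘ sym) = refl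

Informs : ∀ {n} → SignedGraph n → Config n → Fin n → Fin n → Bool
Informs G t w z = adj G w z ∧ isInformed (t z)

message : ∀ {n} → SignedGraph n → Config n → Fin n → Fin n → St
message G t w z = act (sign G w z) (t z)

module _ {n} (G : SignedGraph n) (t : Config n) where

  update-settled : ∀ {w} → t w ≢ O → update G t w ≡ t w
  update-settled {w} tw≢O with t w
  ... | A  = refl
  ... | mA = refl
  ... | C  = refl
  ... | O  = contradiction refl tw≢O

  update-fresh : ∀ {w} → t w ≡ O → update G t w ≡ fromMsgs (received G t w)
  update-fresh {w} tw≡O with t w
  update-fresh refl | O = refl

  informed-message : ∀ {w z} → Informs G t w z ≡ true → Informed (message G t w z)
  informed-message {w} {z} inf = informed-act (sign G w z) (∧-conicalʳ _ _ inf)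

  update-silent : ∀ {w} → t w ≡ O → (∀ z → Informs G t w z ≡ false) → update G t w ≡ O
  update-silent {w} fresh silent =
    trans (update-fresh fresh) (cong fromMsgs (gather-silent (Informs G t w) (message G t w) silent (allFin n)))

  update-heard : ∀ {w z} → t w ≡ O → Informs G t w z ≡ true → update G t w ≢ O
  update-heard {w} {z} fresh inf rewrite update-fresh fresh with received G t w in r
  ... | none  = contradiction r (gather-heard (Informs G t w) (message G t w) (∈-allFin z) inf)
  ... | one y = subst (_≢ O) (gather-sound (Informs G t w) (message G t w) r (∈-allFin z) inf)
                  (informed⇒≢O (informed-message inf))
  ... | conf  = λ ()

  update-coherent : ∀ {w x} → t w ≡ O → (∀ z → Informs G t w z ≡ true → message G t w z ≡ x) →
                    update G t w ≡ O ⊎ update G t w ≡ x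
  update-coherent {w} fresh coherent rewrite update-fresh fresh
    with gather-uniform (Informs G t w) (message G t w) coherent (allFin n)
  ... | inj₁ silent = inj₁ (cong fromMsgs silent)
  ... | inj₂ agreed = inj₂ (cong fromMsgs agreed)

  update-agree : ∀ {w z} → t w ≡ O → Informs G t w z ≡ true →
                 (∀ z′ → Informs G t w z′ ≡ true → message G t w z′ ≡ message G t w z) →
                 update G t w ≡ message G t w z
  update-agree fresh inf coherent with update-coherent fresh coherent
  ... | inj₁ silent = contradiction silent (update-heard fresh inf)
  ... | inj₂ agreed = agreed

  update-conflict : ∀ {w z₁ z₂} → t w ≡ O → Informs G t w z₁ ≡ true → Informs G t w z₂ ≡ true →
                    message G t w z₁ ≢ message G t w z₂ → update G t w ≡ C
  update-conflict {w} {z₁} {z₂} fresh inf₁ inf₂ differ rewrite update-fresh fresh with received G t w in r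
  ... | none  = contradiction r (gather-heard (Informs G t w) (message G t w) (∈-allFin z₁) inf₁)
  ... | one y = contradiction (trans (sound z₁ inf₁) (sym (sound z₂ inf₂))) differ
    where
    sound : ∀ z → Informs G t w z ≡ true → message G t w z ≡ y
    sound z = gather-sound (Informs G t w) (message G t w) r (∈-allFin z)
  ... | conf  = refl

-- The rID process on complete bipartite signed graphs

module CompleteBipartite {n} (G : SignedGraph n) (side : Fin n → Bool)
         (adj-side : ∀ i j → adj G i j ≡ side i xor side j)
         (opposite : ∀ w → ∃ λ z → side z ≢ side w) where

  adjacent : ∀ {i j} → side i ≢ side j → adj G i j ≡ true
  adjacent {i} {j} i≁j rewrite adj-side i j | ¬-not i≁j = xor-not (side j)
    where
    xor-not : ∀ x → not x xor x ≡ true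
    xor-not true  = refl
    xor-not false = refl

  nonadjacent : ∀ {i j} → side i ≡ side j → adj G i j ≡ false
  nonadjacent {i} {j} i∼j = trans (adj-side i j) (trans (cong (_xor side j) i∼j) (xor-same (side j)))

  adjacent⁻¹ : ∀ {i j} → adj G i j ≡ true → side i ≢ side j
  adjacent⁻¹ ij i∼j = contradiction (trans (sym ij) (nonadjacent i∼j)) λ ()

  -- Once x is placed at v, every z across sends act (twist w z v) x to a fresh w beside v.
  twist : Fin n → Fin n → Fin n → Sign
  twist w z v = sign G w z · sign G z v

  UnbalancedSquare : Fin n → Fin n → Set
  UnbalancedSquare v w = ∃₂ λ z₁ z₂ → side z₁ ≢ side v × side z₂ ≢ side v × twist w z₁ v ≢ twist w z₂ v

  Coherent : Fin n → Fin n → Set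
  Coherent v w = ∃ λ σ → ∀ z → side z ≢ side v → twist w z v ≡ σ

  record AfterFirst (v : Fin n) (x : St) (s : Config n) : Set where
    field
      informed : Informed x
      at-first : s v ≡ x
      across   : ∀ w → side w ≢ side v → s w ≡ act (sign G w v) x
      beside   : ∀ w → side w ≡ side v → w ≢ v → s w ≡ O

  record AfterSecond (v u : Fin n) (s : Config n) : Set where
    field
      final         : Final s
      confused      : ∀ w → side w ≡ side v → w ≢ u → w ≢ v → UnbalancedSquare v w → s w ≡ C
      only-confused : ∀ w → s w ≡ C → side w ≡ side v × w ≢ u × ¬ Coherent v w

  first-placement : ∀ {s} → (∀ w → s w ≡ O) → ∀ v a → AfterFirst v (placed a) (rIDStep G s v a)
  first-placement {s} empty v a = record
    { informed = informed-placed a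
    ; at-first = trans (update-settled G t (subst (_≢ O) (sym t-v) (informed⇒≢O (informed-placed a)))) t-v
    ; across   = λ w w≁v → trans
        (update-agree G t (t-else (w≁v ∘ cong side)) (informs-v w≁v) (λ z inf → cong (message G t w) (only-v z inf)))
        (cong (act (sign G w v)) t-v)
    ; beside   = λ w w∼v w≢v → update-silent G t (t-else w≢v) (silent w∼v)
    }
    where
    t : Config n
    t = place s v a
    t-v : t v ≡ placed a
    t-v = place-here s v a
    t-else : ∀ {w} → w ≢ v → t w ≡ O
    t-else w≢v = trans (place-elsewhere s a w≢v) (empty _)
    informs-v : ∀ {w} → side w ≢ side v → Informs G t w v ≡ true
    informs-v w≁v = cong₂ _∧_ (adjacent w≁v) (trans (cong isInformed t-v) (informed-placed a))
    only-v : ∀ {w} z → Informs G t w z ≡ true → z ≡ v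
    only-v z inf with z Fin.≟ v
    ... | yes z≡v = z≡v
    ... | no z≢v  = contradiction (trans (sym (cong isInformed (t-else z≢v))) (∧-conicalʳ _ _ inf)) λ ()
    silent : ∀ {w} → side w ≡ side v → ∀ z → Informs G t w z ≡ false
    silent {w} w∼v z with z Fin.≟ v
    ... | yes refl = cong (_∧ isInformed (t z)) (nonadjacent w∼v)
    ... | no z≢v   = trans (cong (λ y → adj G w z ∧ isInformed y) (t-else z≢v)) (∧-zeroʳ _)

  module SecondPlacement {v x s} (first : AfterFirst v x s) {u} (su≡O : s u ≡ O) (b : Bool) where
    open AfterFirst first

    t : Config n
    t = place s u b

    s₂ : Config n
    s₂ = rIDStep G s u b

    u∼v : side u ≡ side v
    u∼v with side u Bool.≟ side v
    ... | yes u∼v = u∼v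
    ... | no u≁v  = contradiction (trans (sym (across u u≁v)) su≡O) (informed⇒≢O (informed-act _ informed))

    t-else : ∀ {w} → w ≢ u → t w ≡ s w
    t-else = place-elsewhere s b

    t-across : ∀ {z} → side z ≢ side v → t z ≡ act (sign G z v) x
    t-across {z} z≁v = trans (t-else λ { refl → z≁v u∼v }) (across z z≁v)

    kept-informed : ∀ {w y} → t w ≡ y → Informed y → Informed (s₂ w)
    kept-informed tw≡y inf =
      subst Informed (sym (trans (update-settled G t (subst (_≢ O) (sym tw≡y) (informed⇒≢O inf))) tw≡y)) inf

    data Position (w : Fin n) : Set where
      settled : Informed (s₂ w) → Position w
      fresh   : side w ≡ side v → w ≢ u → w ≢ v → Position w

    position : ∀ w → Position w
    position w with w Fin.≟ u | w Fin.≟ v | side w Bool.≟ side v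
    ... | yes refl | _        | _       = settled (kept-informed (place-here s u b) (informed-placed b))
    ... | no w≢u   | yes refl | _       = settled (kept-informed (trans (t-else w≢u) at-first) informed)
    ... | no _     | no _     | no w≁v  = settled (kept-informed (t-across w≁v) (informed-act _ informed))
    ... | no w≢u   | no w≢v   | yes w∼v = fresh w∼v w≢u w≢v

    t-fresh : ∀ {w} → side w ≡ side v → w ≢ u → w ≢ v → t w ≡ O
    t-fresh w∼v w≢u w≢v = trans (t-else w≢u) (beside _ w∼v w≢v)

    informs-across : ∀ {w z} → side w ≡ side v → side z ≢ side v → Informs G t w z ≡ true
    informs-across {w} {z} w∼v z≁v =
      cong₂ _∧_ (adjacent (λ w∼z → z≁v (trans (sym w∼z) w∼v)))
                (trans (cong isInformed (t-across z≁v)) (informed-act _ informed))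

    message-twist : ∀ {w z} → side z ≢ side v → message G t w z ≡ act (twist w z v) x
    message-twist {w} {z} z≁v = trans (cong (act (sign G w z)) (t-across z≁v)) (sym (act-· (sign G w z) (sign G z v) x))

    informer-across : ∀ {w z} → side w ≡ side v → Informs G t w z ≡ true → side z ≢ side v
    informer-across w∼v inf z∼v = adjacent⁻¹ (∧-conicalˡ _ _ inf) (trans w∼v (sym z∼v))

    after : AfterSecond v u s₂
    after = record { final = final ; confused = confused ; only-confused = only-confused }
      where
      final : Final s₂
      final w with position w
      ... | settled inf       = informed⇒≢O inf
      ... | fresh w∼v w≢u w≢v = update-heard G t (t-fresh w∼v w≢u w≢v) (informs-across w∼v z≁v)
        where
        z≁v : side (proj₁ (opposite w)) ≢ side v
        z≁v z∼v = proj₂ (opposite w) (trans z∼v (sym w∼v))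

      confused : ∀ w → side w ≡ side v → w ≢ u → w ≢ v → UnbalancedSquare v w → s₂ w ≡ C
      confused w w∼v w≢u w≢v (z₁ , z₂ , z₁≁v , z₂≁v , twists-differ) =
        update-conflict G t (t-fresh w∼v w≢u w≢v) (informs-across w∼v z₁≁v) (informs-across w∼v z₂≁v)
          λ same → twists-differ (act-cancel informed _ _
            (trans (sym (message-twist z₁≁v)) (trans same (message-twist z₂≁v))))

      only-confused : ∀ w → s₂ w ≡ C → side w ≡ side v × w ≢ u × ¬ Coherent v w
      only-confused w s₂w≡C with position w
      ... | settled inf       = contradiction s₂w≡C (informed⇒≢C inf)
      ... | fresh w∼v w≢u w≢v = w∼v , w≢u , not-coherent
        where
        not-coherent : ¬ Coherent v w
        not-coherent (σ , coherent) with update-coherent G t (t-fresh w∼v w≢u w≢v) uniform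
          where
          uniform : ∀ z → Informs G t w z ≡ true → message G t w z ≡ act σ x
          uniform z inf = let z≁v = informer-across w∼v inf in
            trans (message-twist z≁v) (cong (λ σ′ → act σ′ x) (coherent z z≁v))
        ... | inj₁ silent = contradiction (trans (sym s₂w≡C) silent) λ ()
        ... | inj₂ agreed = contradiction (trans (sym agreed) s₂w≡C) (informed⇒≢C (informed-act σ informed))

  second-placement : ∀ {v x s} → AfterFirst v x s → ∀ {u} → s u ≡ O → ∀ b → AfterSecond v u (rIDStep G s u b)
  second-placement first su≡O b = SecondPlacement.after first su≡O b

  data Stage (s : Config n) : Set where
    initial    : (∀ w → s w ≡ O) → Stage s
    one-placed : ∀ {v x} → AfterFirst v x s → Stage s
    two-placed : ∀ {v u} → AfterSecond v u s → Stage s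

  stage : ∀ {s} → Reachable G s → Stage s
  stage start = initial λ _ → refl
  stage (step r v sv≡O a) with stage r
  ... | initial empty     = one-placed (first-placement empty v a)
  ... | one-placed first  = two-placed (second-placement first sv≡O a)
  ... | two-placed second = contradiction sv≡O (AfterSecond.final second v)

  final-stage : Fin n → (∀ v → ∃ λ w → side w ≡ side v × w ≢ v) →
                ∀ {s} → Reachable G s → Final s → ∃₂ λ v u → AfterSecond v u s
  final-stage w₀ mates r final with stage r
  ... | initial empty     = contradiction (empty w₀) (final w₀)
  ... | one-placed {v} first with mates v
  ...   | w , w∼v , w≢v   = contradiction (AfterFirst.beside first w w∼v w≢v) (final w)
  final-stage _ _ _ _ | two-placed second = _ , _ , second

-- Balance and packings of unbalanced circuits

negative? : Sign → Bool
negative? pos = false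
negative? neg = true

negative?-sound : ∀ {σ} → negative? σ ≡ true → σ ≡ neg
negative?-sound {neg} _ = refl

negativeEdges : ∀ {n} (G : SignedGraph n) → EdgeSet G
negativeEdges G = record
  { mem     = λ i j → adj G i j ∧ negative? (sign G i j)
  ; mem-sym = λ i j → cong₂ _∧_ (adj-sym G i j) (cong negative? (sign-sym G i j))
  ; mem-adj = λ i j → ∧-conicalˡ _ _
  }

module _ {n} (σ : Fin n → Fin n → Sign) where

  negCount-positive : ∀ {L} → All (λ e → σ (proj₁ e) (proj₂ e) ≡ pos) L → negCount σ L ≡ 0
  negCount-positive []                          = refl
  negCount-positive {(i , j) ∷ L} (σij≡pos ∷ rest) rewrite σij≡pos = negCount-positive rest

  balanced-if-positive : ∀ {E} → (∀ i j → E i j ≡ true → σ i j ≡ pos) → Balanced E σ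
  balanced-if-positive positive cs (_ , _ , edges) =
    subst (2 ∣_) (sym (negCount-positive (All.map (λ {e} → positive (proj₁ e) (proj₂ e)) edges))) (2 ∣0)

  negCount-square : ∀ {a b c d} → σ a b ≡ neg → σ b c ≡ pos → σ c d ≡ pos → σ d a ≡ pos →
                    negCount σ (closedPairs (a ∷ b ∷ c ∷ d ∷ [])) ≡ 1
  negCount-square ab bc cd da rewrite ab | bc | cd | da = refl

negativeEdges-balanced : ∀ {n} (G : SignedGraph n) → Balanced (deleteAdj G (negativeEdges G)) (sign G)
negativeEdges-balanced G = balanced-if-positive (sign G) kept-positive
  where
  kept-positive : ∀ i j → deleteAdj G (negativeEdges G) i j ≡ true → sign G i j ≡ pos
  kept-positive i j kept with adj G i j | sign G i j
  ... | true  | pos = refl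
  ... | true  | neg = contradiction kept λ ()
  ... | false | _   = contradiction kept λ ()

-- label witnesses that the circuits are edge-disjoint.
record UnbalancedPacking {n} (G : SignedGraph n) (k : ℕ) : Set where
  field
    circuit    : Fin k → List (Fin n)
    label      : Fin n → Fin n → ℕ
    is-circuit : ∀ t → IsCircuit (adj G) (circuit t)
    unbalanced : ∀ t → ¬ 2 ∣ negCount (sign G) (closedPairs (circuit t))
    labelled   : ∀ t → All (λ e → label (proj₁ e) (proj₂ e) ≡ toℕ t) (closedPairs (circuit t))
    label-sym  : ∀ i j → adj G i j ≡ true → label i j ≡ label j i

packing-≤-card : ∀ {n k} {G : SignedGraph n} → UnbalancedPacking G k →
                 (E : EdgeSet G) → Balanced (deleteAdj G E) (sign G) → k ≤ card E
packing-≤-card {n} {k} {G} packing E balanced =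
  countPairs-injection Q (proj₁ ∘ chosen) chosen-injective (proj₁ ∘ proj₂ ∘ chosen)
  where
  open UnbalancedPacking packing

  Q : Fin n → Fin n → Bool
  Q i j = ltB (toℕ i) (toℕ j) ∧ mem E i j

  hit : ∀ t → Any (λ e → mem E (proj₁ e) (proj₂ e) ≡ true) (closedPairs (circuit t))
  hit t with any? (λ e → mem E (proj₁ e) (proj₂ e) Bool.≟ true) (closedPairs (circuit t))
  ... | yes h   = h
  ... | no miss = contradiction (balanced (circuit t) survives) (unbalanced t)
    where
    survives : IsCircuit (deleteAdj G E) (circuit t)
    survives with is-circuit t
    ... | long , unique , edges =
      long , unique , All.zipWith (λ (a , m) → cong₂ _∧_ a (cong not (¬-not m))) (edges , ¬Any⇒All¬ _ miss)

  oriented : ∀ {i j} → mem E i j ≡ true → ∃ λ e → uncurry Q e ≡ true × uncurry label e ≡ label i j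
  oriented {i} {j} ij with <-cmp (toℕ i) (toℕ j)
  ... | tri< i<j _ _ = (i , j) , cong₂ _∧_ (ltB-complete i<j) ij , refl
  ... | tri≈ _ i≡j _ with refl ← toℕ-injective {i = i} {j} i≡j =
    contradiction (trans (sym (mem-adj E i i ij)) (adj-irrefl G i)) λ ()
  ... | tri> _ _ j<i =
    (j , i) , cong₂ _∧_ (ltB-complete j<i) (trans (mem-sym E j i) ij) , sym (label-sym i j (mem-adj E i j ij))

  chosen : ∀ t → ∃ λ e → uncurry Q e ≡ true × uncurry label e ≡ toℕ t
  chosen t with All.lookupAny (labelled t) (hit t)
  ... | labelled-t , in-E with oriented in-E
  ...   | e , Qe , same-label = e , Qe , trans same-label labelled-t

  chosen-injective : Injective _≡_ _≡_ (proj₁ ∘ chosen)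
  chosen-injective {t} {t′} eq = toℕ-injective (begin
    toℕ t                               ≡⟨ proj₂ (proj₂ (chosen t)) ⟨
    uncurry label (proj₁ (chosen t))    ≡⟨ cong (uncurry label) eq ⟩
    uncurry label (proj₁ (chosen t′))   ≡⟨ proj₂ (proj₂ (chosen t′)) ⟩
    toℕ t′                              ∎)
    where open ≡-Reasoning

-- The graphs NegMatching n b

odd : ℕ → Bool
odd zero          = false
odd (suc zero)    = true
odd (suc (suc x)) = odd x

halves-injective : ∀ x y → ⌊ x /2⌋ ≡ ⌊ y /2⌋ → odd x ≡ odd y → x ≡ y
halves-injective zero          zero          _  _  = refl
halves-injective (suc zero)    (suc zero)    _  _  = refl
halves-injective (suc (suc x)) (suc (suc y)) hx ox = cong (2 +_) (halves-injective x y (ℕ.suc-injective hx) ox)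
halves-injective zero          (suc zero)    _  ()
halves-injective (suc zero)    zero          _  ()
halves-injective zero          (suc (suc y)) () _
halves-injective (suc zero)    (suc (suc y)) () _
halves-injective (suc (suc x)) zero          () _
halves-injective (suc (suc x)) (suc zero)    () _

even-before-odd : ∀ x y → ⌊ x /2⌋ ≡ ⌊ y /2⌋ → odd x ≡ false → odd y ≡ true → x < y
even-before-odd zero          (suc zero)    _  _  _  = s≤s z≤n
even-before-odd (suc (suc x)) (suc (suc y)) hx ox oy = s≤s (s≤s (even-before-odd x y (ℕ.suc-injective hx) ox oy))
even-before-odd zero          (suc (suc y)) () _  _
even-before-odd (suc (suc x)) (suc zero)    () _  _
even-before-odd (suc zero)    _             _  () _
even-before-odd _             zero          _  _  ()

level : ∀ {n} → Fin n → ℕ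
level i = ⌊ toℕ i /2⌋

side : ∀ {n} → Fin n → Bool
side i = odd (toℕ i)

level-side-injective : ∀ {n} {i j : Fin n} → level i ≡ level j → side i ≡ side j → i ≡ j
level-side-injective lij sij = toℕ-injective (halves-injective _ _ lij sij)

pos-unless-neg : ∀ {σ} → σ ≢ neg → σ ≡ pos
pos-unless-neg {pos} _      = refl
pos-unless-neg {neg} σ≢neg = contradiction refl σ≢neg

matchingSign : ℕ → ℕ → ℕ → Sign
matchingSign (suc b) zero    zero    = neg
matchingSign (suc b) (suc x) (suc y) = matchingSign b x y
matchingSign _       _       _       = pos

matchingSign-sym : ∀ b x y → matchingSign b x y ≡ matchingSign b y x
matchingSign-sym zero    _       _       = refl
matchingSign-sym (suc b) zero    zero    = refl
matchingSign-sym (suc b) zero    (suc y) = refl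
matchingSign-sym (suc b) (suc x) zero    = refl
matchingSign-sym (suc b) (suc x) (suc y) = matchingSign-sym b x y

matchingSign-neg : ∀ {b x} → x < b → matchingSign b x x ≡ neg
matchingSign-neg {suc b} {zero}  _         = refl
matchingSign-neg {suc b} {suc x} (s≤s x<b) = matchingSign-neg x<b

matchingSign-neg⁻¹ : ∀ {b} x y → matchingSign b x y ≡ neg → x ≡ y × x < b
matchingSign-neg⁻¹ {suc b} zero    zero    _  = refl , s≤s z≤n
matchingSign-neg⁻¹ {suc b} (suc x) (suc y) eq =
  let x≡y , x<b = matchingSign-neg⁻¹ x y eq in cong suc x≡y , s≤s x<b
matchingSign-neg⁻¹ {zero}  _       _       ()
matchingSign-neg⁻¹ {suc b} zero    (suc y) ()
matchingSign-neg⁻¹ {suc b} (suc x) zero    ()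

NegMatching : (n b : ℕ) → SignedGraph n
NegMatching n b = record
  { adj        = λ i j → side i xor side j
  ; adj-sym    = λ i j → xor-comm (side i) (side j)
  ; adj-irrefl = λ i → xor-same (side i)
  ; sign       = λ i j → matchingSign b (level i) (level j)
  ; sign-sym   = λ i j → matchingSign-sym b (level i) (level j)
  }

vertex : ∀ {m} → Fin m → Bool → Fin (m * 2)
vertex zero    false = zero
vertex zero    true  = suc zero
vertex (suc t) p     = suc (suc (vertex t p))

level-vertex : ∀ {m} (t : Fin m) p → level (vertex t p) ≡ toℕ t
level-vertex zero    false = refl
level-vertex zero    true  = refl
level-vertex (suc t) p     = cong suc (level-vertex t p)

side-vertex : ∀ {m} (t : Fin m) p → side (vertex t p) ≡ p
side-vertex zero    false = refl
side-vertex zero    true  = refl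
side-vertex (suc t) p     = side-vertex t p

mate : ∀ {m} → Fin (m * 2) → Fin (m * 2)
mate {suc m} zero          = suc zero
mate {suc m} (suc zero)    = zero
mate {suc m} (suc (suc i)) = suc (suc (mate {m} i))

level-mate : ∀ {m} (i : Fin (m * 2)) → level (mate {m} i) ≡ level i
level-mate {suc m} zero          = refl
level-mate {suc m} (suc zero)    = refl
level-mate {suc m} (suc (suc i)) = cong suc (level-mate {m} i)

side-mate : ∀ {m} (i : Fin (m * 2)) → side (mate {m} i) ≡ not (side i)
side-mate {suc m} zero          = refl
side-mate {suc m} (suc zero)    = refl
side-mate {suc m} (suc (suc i)) = side-mate {m} i

below : ∀ {n} → Bool → ℕ → Fin n → Bool
below p b i = ltB (level i) b ∧ does (side i Bool.≟ p)

below-intro : ∀ {n p b} {i : Fin n} → side i ≡ p → level i < b → below p b i ≡ true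
below-intro {p = p} {i = i} si≡p li<b = cong₂ _∧_ (ltB-complete li<b) (dec-true (side i Bool.≟ p) si≡p)

below-elim : ∀ {n p b} {i : Fin n} → below p b i ≡ true → side i ≡ p × level i < b
below-elim {p = p} {b} {i} eq with side i Bool.≟ p
... | yes si≡p = si≡p , ltB-sound (∧-conicalˡ (ltB (level i) b) true eq)
... | no  _    = contradiction (∧-conicalʳ (ltB (level i) b) false eq) λ ()

count-below : ∀ m b p → b ≤ m → countFin {m * 2} (below p b) ≡ b
count-below m       zero    p _         = countFin-empty {m * 2} λ i → cong (_∧ does (side i Bool.≟ p)) (ltB-zero (level i))
  where
  ltB-zero : ∀ x → ltB x 0 ≡ false
  ltB-zero zero    = refl
  ltB-zero (suc x) = refl
count-below (suc m) (suc b) p (s≤s b≤m) = begin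
  countFin P
    ≡⟨ countFin-suc P ⟩
  indicator (P zero) + countFin (P ∘ suc)
    ≡⟨ cong (indicator (P zero) +_) (countFin-suc (P ∘ suc)) ⟩
  indicator (P zero) + (indicator (P (suc zero)) + countFin (below {m * 2} p b))
    ≡⟨ cong (λ c → indicator (P zero) + (indicator (P (suc zero)) + c)) (count-below m b p b≤m) ⟩
  indicator (P zero) + (indicator (P (suc zero)) + b)
    ≡⟨ one-per-level p ⟩
  suc b ∎
  where
  open ≡-Reasoning
  P : Fin (suc m * 2) → Bool
  P = below p (suc b)
  one-per-level : ∀ p → indicator (does (false Bool.≟ p)) + (indicator (does (true Bool.≟ p)) + b) ≡ suc b
  one-per-level false = refl
  one-per-level true  = refl

smaller-end-even : ∀ {n} {i j : Fin n} → toℕ i < toℕ j → side i ≢ side j → level i ≡ level j → side i ≡ false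
smaller-end-even {i = i} {j} i<j i≁j lij with side i in si | side j in sj
... | false | _     = refl
... | true  | true  = contradiction refl i≁j
... | true  | false = contradiction (even-before-odd (toℕ j) (toℕ i) (sym lij) sj si) (ℕ.<-asym i<j)

-- The square of level t consists of the edges whose (even, odd) end levels are (t, t),
-- (t+1, t), (t+1, t+2) and (t, t+2); squareIndex recovers t from each of them.
squareIndex : ℕ → ℕ → ℕ
squareIndex e o = if does (o ℕ.≟ suc e) ∨ does (suc o ℕ.≟ e) then pred e else e

squareIndex-by : ∀ e o {x y} → does (o ℕ.≟ suc e) ≡ x → does (suc o ℕ.≟ e) ≡ y →
                 squareIndex e o ≡ (if x ∨ y then pred e else e)
squareIndex-by e o = cong₂ (λ x y → if x ∨ y then pred e else e)

squareIndex-diag : ∀ t → squareIndex t t ≡ t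
squareIndex-diag t = squareIndex-by t t (dec-false (t ℕ.≟ suc t) λ ()) (dec-false (suc t ℕ.≟ t) λ ())

squareIndex-back : ∀ t → squareIndex (suc t) t ≡ t
squareIndex-back t = squareIndex-by (suc t) t
  (dec-false (t ℕ.≟ suc (suc t)) λ ()) (dec-true (suc t ℕ.≟ suc t) refl)

squareIndex-up : ∀ t → squareIndex (suc t) (suc (suc t)) ≡ t
squareIndex-up t = squareIndex-by (suc t) (suc (suc t)) {y = false}
  (dec-true (suc (suc t) ℕ.≟ suc (suc t)) refl) (dec-false (suc (suc (suc t)) ℕ.≟ suc t) λ ())

squareIndex-far : ∀ t → squareIndex t (suc (suc t)) ≡ t
squareIndex-far t = squareIndex-by t (suc (suc t))
  (dec-false (suc (suc t) ℕ.≟ suc t) λ ()) (dec-false (suc (suc (suc t)) ℕ.≟ t) λ ())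

squareLabel : ∀ {n} → Fin n → Fin n → ℕ
squareLabel i j = if side i then squareIndex (level j) (level i) else squareIndex (level i) (level j)

squareLabel-even : ∀ {n} {i j : Fin n} → side i ≡ false → squareLabel i j ≡ squareIndex (level i) (level j)
squareLabel-even {i = i} {j} = cong λ s → if s then squareIndex (level j) (level i) else squareIndex (level i) (level j)

squareLabel-odd : ∀ {n} {i j : Fin n} → side i ≡ true → squareLabel i j ≡ squareIndex (level j) (level i)
squareLabel-odd {i = i} {j} = cong λ s → if s then squareIndex (level j) (level i) else squareIndex (level i) (level j)

squareLabel-sym : ∀ {n} {i j : Fin n} → side i ≢ side j → squareLabel i j ≡ squareLabel j i
squareLabel-sym {i = i} {j} i≁j with side i | side j
... | true  | false = refl
... | false | true  = refl
... | true  | true  = contradiction refl i≁j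
... | false | false = contradiction refl i≁j

-- Confusion number and frustration index of the graphs NegMatching (2m) (m − 2)

module _ (k : ℕ) where

  private
    m n : ℕ
    m = 3 + k
    n = m * 2

    G : SignedGraph n
    G = NegMatching n (suc k)

    mate-opposite : ∀ (w : Fin n) → side (mate {m} w) ≢ side w
    mate-opposite w eq = not-¬ refl (trans (sym eq) (side-mate {m} w))

  open CompleteBipartite G side (λ _ _ → refl) (λ w → mate {m} w , mate-opposite w)

  private
    sign-level : ∀ {i j} → level i ≢ level j → sign G i j ≡ pos
    sign-level {i} {j} li≢lj = pos-unless-neg (li≢lj ∘ proj₁ ∘ matchingSign-neg⁻¹ {suc k} (level i) (level j))

    sign-high : ∀ {i j} → suc k ≤ level i → sign G i j ≡ pos
    sign-high {i} {j} high = pos-unless-neg λ eq → ℕ.<⇒≱ (proj₂ (matchingSign-neg⁻¹ {suc k} (level i) (level j) eq)) high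

    sign-mate : ∀ {i} → level i < suc k → sign G i (mate {m} i) ≡ neg
    sign-mate {i} low = subst (λ l → matchingSign (suc k) (level i) l ≡ neg) (sym (level-mate {m} i)) (matchingSign-neg low)

    fresh-level : ∀ x y → ∃ λ (t : Fin m) → toℕ t ≢ x × toℕ t ≢ y
    fresh-level (suc _)       (suc _)       = zero , (λ ()) , (λ ())
    fresh-level zero          (suc zero)    = suc (suc zero) , (λ ()) , (λ ())
    fresh-level (suc zero)    zero          = suc (suc zero) , (λ ()) , (λ ())
    fresh-level zero          zero          = suc zero , (λ ()) , (λ ())
    fresh-level zero          (suc (suc _)) = suc zero , (λ ()) , (λ ())
    fresh-level (suc (suc _)) zero          = suc zero , (λ ()) , (λ ())

    another-beside : ∀ v → ∃ λ w → side w ≡ side v × w ≢ v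
    another-beside v with fresh-level (level v) (level v)
    ... | t , t≢lv , _ = vertex t (side v) , side-vertex t (side v) ,
                         λ eq → t≢lv (trans (sym (level-vertex t (side v))) (cong level eq))

    unbalanced-low : ∀ {v w} → side w ≡ side v → w ≢ v → level w < suc k ⊎ level v < suc k → UnbalancedSquare v w
    unbalanced-low {v} {w} w∼v w≢v low with negative-path low | fresh-level (level w) (level v)
      where
      lw≢lv : level w ≢ level v
      lw≢lv lw≡lv = w≢v (level-side-injective lw≡lv w∼v)
      negative-path : level w < suc k ⊎ level v < suc k → ∃ λ z → side z ≢ side v × twist w z v ≡ neg
      negative-path (inj₁ lw<b) = mate {m} w , (λ eq → mate-opposite w (trans eq (sym w∼v))) ,
        cong₂ _·_ (sign-mate lw<b) (sign-level (lw≢lv ∘ trans (sym (level-mate {m} w))))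
      negative-path (inj₂ lv<b) = mate {m} v , mate-opposite v ,
        cong₂ _·_ (sign-level (lw≢lv ∘ flip trans (level-mate {m} v)))
                  (trans (sign-sym G (mate {m} v) v) (sign-mate lv<b))
    ... | z₁ , z₁≁v , twist-z₁ | t , t≢lw , t≢lv =
      z₁ , z , z₁≁v , z≁v , λ eq → contradiction (trans (sym twist-z₁) (trans eq twist-z)) λ ()
      where
      z : Fin n
      z = vertex t (not (side v))
      z≁v : side z ≢ side v
      z≁v eq = not-¬ refl (trans (sym eq) (side-vertex t (not (side v))))
      lz : level z ≡ toℕ t
      lz = level-vertex t (not (side v))
      twist-z : twist w z v ≡ pos
      twist-z = cong₂ _·_ (sign-level (t≢lw ∘ trans (sym lz) ∘ sym)) (sign-level (t≢lv ∘ trans (sym lz)))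

    coherent-high : ∀ {v w} → suc k ≤ level w → suc k ≤ level v → Coherent v w
    coherent-high {v} {w} w-high v-high = pos , λ z _ →
      cong₂ _·_ (sign-high {w} {z} w-high) (trans (sign-sym G z v) (sign-high {v} {z} v-high))

  private
    count-confused-but-one : ∀ {s} (p : Fin n → Bool) u → (∀ w → p w ≡ true → w ≢ u → s w ≡ C) →
                             countFin p ≤ suc (countC s)
    count-confused-but-one p u confused′ = ≤-trans (countFin-∖-≤ p u) (s≤s (countFin-mono λ w in-p∖u →
      let in-p , w≢u = ∖-elim {p = p} in-p∖u in cong (λ y → eqSt y C) (confused′ w in-p w≢u)))

    confusion-lower : ∀ {s} → Reachable G s → Final s → k ≤ countC s
    confusion-lower {s} r final with final-stage (vertex {m} zero false) another-beside r final
    ... | v , u , after with level v ℕ.<? suc k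
    ...   | yes lv<b = ℕ.<⇒≤ (ℕ.≤-pred (ℕ.≤-pred (begin
            3 + k                          ≡⟨ count-below m m (side v) ℕ.≤-refl ⟨
            countFin beside-v              ≤⟨ countFin-∖-≤ beside-v v ⟩
            suc (countFin (beside-v ∖ v))  ≤⟨ s≤s (count-confused-but-one (beside-v ∖ v) u all-confused) ⟩
            2 + countC s                   ∎)))
      where
      open ℕ.≤-Reasoning
      beside-v : Fin n → Bool
      beside-v = below (side v) m
      all-confused : ∀ w → (beside-v ∖ v) w ≡ true → w ≢ u → s w ≡ C
      all-confused w in-p w≢u with ∖-elim {p = beside-v} in-p
      ... | in-beside , w≢v = let w∼v = proj₁ (below-elim {i = w} in-beside) in
        AfterSecond.confused after w w∼v w≢u w≢v (unbalanced-low {v} {w} w∼v w≢v (inj₂ lv<b))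
    ...   | no lv≮b = ℕ.≤-pred (begin
            suc k                    ≡⟨ count-below m (suc k) (side v) (ℕ.m≤n+m (suc k) 2) ⟨
            countFin low-beside-v    ≤⟨ count-confused-but-one low-beside-v u low-confused ⟩
            suc (countC s)           ∎)
      where
      open ℕ.≤-Reasoning
      low-beside-v : Fin n → Bool
      low-beside-v = below (side v) (suc k)
      low-confused : ∀ w → low-beside-v w ≡ true → w ≢ u → s w ≡ C
      low-confused w in-p w≢u with below-elim {i = w} in-p
      ... | w∼v , lw<b = AfterSecond.confused after w w∼v w≢u w≢v (unbalanced-low {v} {w} w∼v w≢v (inj₁ lw<b))
        where
        w≢v : w ≢ v
        w≢v refl = lv≮b lw<b

    -- All edges at top are positive, so only the even vertices below level suc k can be confused.
    top bottom : Fin n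
    top    = vertex {m} (Fin.fromℕ (2 + k)) false
    bottom = vertex {m} zero false

    top-high : suc k ≤ level top
    top-high = subst (suc k ≤_) (sym (trans (level-vertex (Fin.fromℕ (2 + k)) false) (Fin.toℕ-fromℕ (2 + k))))
                     (ℕ.n≤1+n (suc k))

    top-placed : AfterFirst top (placed true) (rIDStep G (λ _ → O) top true)
    top-placed = first-placement (λ _ → refl) top true

    bottom-fresh : rIDStep G (λ _ → O) top true bottom ≡ O
    bottom-fresh = AfterFirst.beside top-placed bottom
      (trans (side-vertex {m} zero false) (sym (side-vertex (Fin.fromℕ (2 + k)) false)))
      λ eq → ℕ.<⇒≱ ℕ.0<1+n (subst (suc k ≤_) (trans (cong level (sym eq)) (level-vertex {m} zero false)) top-high)

    witness : Config n
    witness = rIDStep G (rIDStep G (λ _ → O) top true) bottom true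

    witness-reached : Reachable G witness
    witness-reached = step (step start top refl true) bottom bottom-fresh true

    witness-after : AfterSecond top bottom witness
    witness-after = second-placement top-placed bottom-fresh true

    witness-upper : countC witness ≤ k
    witness-upper = begin
      countC witness                ≤⟨ countFin-mono confused⇒low ⟩
      countFin (low-even ∖ bottom)  ≡⟨ ℕ.suc-injective (trans (sym (countFin-∖ {p = low-even} {bottom} bottom-low))
                                                           (count-below m (suc k) false (ℕ.m≤n+m (suc k) 2))) ⟩
      k                             ∎
      where
      open ℕ.≤-Reasoning
      low-even : Fin n → Bool
      low-even = below false (suc k)
      bottom-low : low-even bottom ≡ true
      bottom-low = below-intro {b = suc k} {bottom} (side-vertex {m} zero false) ℕ.0<1+n
      confused⇒low : ∀ w → eqSt (witness w) C ≡ true → (low-even ∖ bottom) w ≡ true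
      confused⇒low w is-C with AfterSecond.only-confused witness-after w (eqSt-sound _ _ is-C)
      ... | w∼top , w≢bottom , incoherent =
        ∖-intro {p = low-even} (below-intro {i = w} (trans w∼top (side-vertex (Fin.fromℕ (2 + k)) false))
                   (ℕ.≰⇒> λ w-high → incoherent (coherent-high {top} {w} w-high top-high))) w≢bottom

  negMatching-relaxedConfusionNumber : IsRelaxedConfusionNumber (NegMatching ((3 + k) * 2) (suc k)) k
  negMatching-relaxedConfusionNumber =
    (witness , witness-reached , final , ℕ.≤-antisym witness-upper (confusion-lower witness-reached final)) ,
    λ _ → confusion-lower
    where
    final : Final witness
    final = AfterSecond.final witness-after

  private
    negative-edge⁻¹ : ∀ {i j} → mem (negativeEdges G) i j ≡ true → side i ≢ side j × level i ≡ level j × level i < suc k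
    negative-edge⁻¹ {i} {j} ij =
      adjacent⁻¹ {i} {j} (∧-conicalˡ (adj G i j) _ ij) ,
      matchingSign-neg⁻¹ {suc k} (level i) (level j) (negative?-sound (∧-conicalʳ (adj G i j) _ ij))

    card-negative : card (negativeEdges G) ≤ suc k
    card-negative = subst (card (negativeEdges G) ≤_) (count-below m (suc k) false (ℕ.m≤n+m (suc k) 2))
      (countPairs-functional Q (below false (suc k)) starts-even unique-partner)
      where
      Q : Fin n → Fin n → Bool
      Q i j = ltB (toℕ i) (toℕ j) ∧ mem (negativeEdges G) i j
      starts-even : ∀ i j → Q i j ≡ true → below false (suc k) i ≡ true
      starts-even i j Qij with negative-edge⁻¹ {i} {j} (∧-conicalʳ (ltB (toℕ i) (toℕ j)) _ Qij)
      ... | i≁j , lij , li<b = below-intro {i = i} (smaller-end-even (ltB-sound (∧-conicalˡ _ _ Qij)) i≁j lij) li<b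
      unique-partner : ∀ i j j′ → Q i j ≡ true → Q i j′ ≡ true → j ≡ j′
      unique-partner i j j′ Qij Qij′
        with negative-edge⁻¹ {i} {j} (∧-conicalʳ (ltB (toℕ i) (toℕ j)) _ Qij)
           | negative-edge⁻¹ {i} {j′} (∧-conicalʳ (ltB (toℕ i) (toℕ j′)) _ Qij′)
      ... | i≁j , lij , _ | i≁j′ , lij′ , _ =
        level-side-injective (trans (sym lij) lij′) (trans (¬-not (i≁j ∘ sym)) (sym (¬-not (i≁j′ ∘ sym))))

    module Square (t : Fin (suc k)) where
      t₀ t₁ t₂ : Fin m
      t₀ = Fin.inject₁ (Fin.inject₁ t)
      t₁ = suc (Fin.inject₁ t)
      t₂ = suc (suc t)

      a b c d : Fin n
      a = vertex t₀ false
      b = vertex t₀ true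
      c = vertex t₁ false
      d = vertex t₂ true

      level-t₀ : toℕ t₀ ≡ toℕ t
      level-t₀ = trans (Fin.toℕ-inject₁ _) (Fin.toℕ-inject₁ t)

      level-a : level a ≡ toℕ t
      level-a = trans (level-vertex t₀ false) level-t₀
      level-b : level b ≡ toℕ t
      level-b = trans (level-vertex t₀ true) level-t₀
      level-c : level c ≡ suc (toℕ t)
      level-c = trans (level-vertex t₁ false) (cong suc (Fin.toℕ-inject₁ t))
      level-d : level d ≡ suc (suc (toℕ t))
      level-d = level-vertex t₂ true

      even≁odd : ∀ {i j : Fin n} → side i ≡ false → side j ≡ true → side i ≢ side j
      even≁odd si sj eq = contradiction (trans (sym si) (trans eq sj)) λ ()

      a≁b : side a ≢ side b
      a≁b = even≁odd {a} {b} (side-vertex t₀ false) (side-vertex t₀ true)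
      c≁b : side c ≢ side b
      c≁b = even≁odd {c} {b} (side-vertex t₁ false) (side-vertex t₀ true)
      c≁d : side c ≢ side d
      c≁d = even≁odd {c} {d} (side-vertex t₁ false) (side-vertex t₂ true)
      a≁d : side a ≢ side d
      a≁d = even≁odd {a} {d} (side-vertex t₀ false) (side-vertex t₂ true)

      la≢lc : level a ≢ level c
      la≢lc eq = ℕ.1+n≢n (sym (trans (sym level-a) (trans eq level-c)))
      lb≢lc : level b ≢ level c
      lb≢lc eq = ℕ.1+n≢n (sym (trans (sym level-b) (trans eq level-c)))
      lc≢ld : level c ≢ level d
      lc≢ld eq = ℕ.1+n≢n (sym (trans (sym level-c) (trans eq level-d)))
      lb≢ld : level b ≢ level d
      lb≢ld eq = ℕ.<⇒≢ (ℕ.m<n⇒m<1+n (ℕ.n<1+n (toℕ t))) (trans (sym level-b) (trans eq level-d))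
      ld≢la : level d ≢ level a
      ld≢la eq = ℕ.<⇒≢ (ℕ.m<n⇒m<1+n (ℕ.n<1+n (toℕ t))) (sym (trans (sym level-d) (trans eq level-a)))

      circuit : List (Fin n)
      circuit = a ∷ b ∷ c ∷ d ∷ []

      is-circuit : IsCircuit (adj G) circuit
      is-circuit = s≤s (s≤s (s≤s z≤n)) ,
        ((apart a≁b ∷ apart′ la≢lc ∷ apart a≁d ∷ []) ∷
         (apart (c≁b ∘ sym) ∷ apart′ lb≢ld ∷ []) ∷
         (apart c≁d ∷ []) ∷ [] ∷ []) ,
        (adjacent {a} {b} a≁b ∷ adjacent {b} {c} (c≁b ∘ sym) ∷
         adjacent {c} {d} c≁d ∷ adjacent {d} {a} (a≁d ∘ sym) ∷ [])
        where
        apart : ∀ {i j : Fin n} → side i ≢ side j → i ≢ j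
        apart i≁j = i≁j ∘ cong side
        apart′ : ∀ {i j : Fin n} → level i ≢ level j → i ≢ j
        apart′ li≢lj = li≢lj ∘ cong level

      unbalanced : ¬ 2 ∣ negCount (sign G) (closedPairs circuit)
      unbalanced 2∣ =
        contradiction (∣1⇒≡1 (subst (2 ∣_) (negCount-square (sign G) {a} {b} {c} {d} ab bc cd da) 2∣)) λ ()
        where
        ab : sign G a b ≡ neg
        ab = subst₂ (λ x y → matchingSign (suc k) x y ≡ neg) (sym level-a) (sym level-b) (matchingSign-neg (Fin.toℕ<n t))
        bc : sign G b c ≡ pos
        bc = sign-level {b} {c} lb≢lc
        cd : sign G c d ≡ pos
        cd = sign-level {c} {d} lc≢ld
        da : sign G d a ≡ pos
        da = sign-level {d} {a} ld≢la

      labelled : All (λ e → squareLabel (proj₁ e) (proj₂ e) ≡ toℕ t) (closedPairs circuit)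
      labelled =
        trans (squareLabel-even {i = a} {b} (side-vertex t₀ false))
              (trans (cong₂ squareIndex level-a level-b) (squareIndex-diag _)) ∷
        trans (squareLabel-odd {i = b} {c} (side-vertex t₀ true))
              (trans (cong₂ squareIndex level-c level-b) (squareIndex-back _)) ∷
        trans (squareLabel-even {i = c} {d} (side-vertex t₁ false))
              (trans (cong₂ squareIndex level-c level-d) (squareIndex-up _)) ∷
        trans (squareLabel-odd {i = d} {a} (side-vertex t₂ true))
              (trans (cong₂ squareIndex level-a level-d) (squareIndex-far _)) ∷ []

    squares : UnbalancedPacking G (suc k)
    squares = record
      { circuit    = Square.circuit
      ; label      = squareLabel
      ; is-circuit = Square.is-circuit
      ; unbalanced = Square.unbalanced
      ; labelled   = Square.labelled
      ; label-sym  = λ i j ij → squareLabel-sym {i = i} {j} (adjacent⁻¹ {i} {j} ij)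
      }

  negMatching-frustrationIndex : IsFrustrationIndex (NegMatching ((3 + k) * 2) (suc k)) (suc k)
  negMatching-frustrationIndex =
    (negativeEdges G , balanced , ℕ.≤-antisym card-negative (packing-≤-card squares (negativeEdges G) balanced)) ,
    packing-≤-card squares
    where
    balanced : Balanced (deleteAdj G (negativeEdges G)) (sign G)
    balanced = negativeEdges-balanced G

⌊n*2/2⌋≡n : ∀ n → ⌊ n * 2 /2⌋ ≡ n
⌊n*2/2⌋≡n zero    = refl
⌊n*2/2⌋≡n (suc n) = cong suc (⌊n*2/2⌋≡n n)

H : (n : ℕ) → SignedGraph n
H n = NegMatching n (⌊ n /2⌋ ∸ 2)

H-values : ∀ n → 8 ≤ n → 2 ∣ n →
           IsRelaxedConfusionNumber (H n) (⌊ n /2⌋ ∸ 3) × IsFrustrationIndex (H n) (⌊ n /2⌋ ∸ 2) ×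
           ⌊ n /2⌋ ∸ 3 < ⌊ n /2⌋ ∸ 2
H-values _ 8≤n (divides (suc (suc (suc k))) refl) rewrite ⌊n*2/2⌋≡n k =
  negMatching-relaxedConfusionNumber k , negMatching-frustrationIndex k , ℕ.n<1+n k
H-values _ () (divides zero refl)
H-values _ (s≤s (s≤s ())) (divides (suc zero) refl)
H-values _ (s≤s (s≤s (s≤s (s≤s ())))) (divides (suc (suc zero)) refl)

H-ratio : ∀ j n → (4 + j) * 2 ≤ n → 2 ∣ n → suc j * ((⌊ n /2⌋ ∸ 2) ∸ (⌊ n /2⌋ ∸ 3)) < ⌊ n /2⌋ ∸ 2
H-ratio j _ N≤n (divides (suc (suc (suc k))) refl) rewrite ⌊n*2/2⌋≡n k | ℕ.m+n∸n≡m 1 k | ℕ.*-identityʳ (suc j) =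
  s≤s (ℕ.≤-pred (ℕ.≤-pred (ℕ.≤-pred (ℕ.*-cancelʳ-≤ (4 + j) (3 + k) 2 N≤n))))
H-ratio j _ () (divides zero refl)
H-ratio j _ (s≤s (s≤s ())) (divides (suc zero) refl)
H-ratio j _ (s≤s (s≤s (s≤s (s≤s ())))) (divides (suc (suc zero)) refl)

theorem3p8 : Σ ((n : ℕ) → SignedGraph n) λ H →
    Σ (ℕ → ℕ) λ c → Σ (ℕ → ℕ) λ ℓ →
      (∀ n → 8 ≤ n → 2 ∣ n →
        IsRelaxedConfusionNumber (H n) (c n) ×
        IsFrustrationIndex (H n) (ℓ n) ×
        c n < ℓ n) ×
      (∀ k → Σ ℕ λ N → ∀ n → N ≤ n → 8 ≤ n → 2 ∣ n →
        suc k * (ℓ n ∸ c n) < ℓ n)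
theorem3p8 = H , (λ n → ⌊ n /2⌋ ∸ 3) , (λ n → ⌊ n /2⌋ ∸ 2) , H-values ,
  λ j → (4 + j) * 2 , λ n N≤n _ 2∣n → H-ratio j n N≤n 2∣n
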